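{- Let $Q\ge3$ and $r\ge2$. Suppose $a_1/q_1<a_2/q_2<\cdots<a_{r+1}/q_{r+1}$ are consecutive elements of $\mathcal F_Q$ (in lowest terms) with $a_1/q_1,\ a_{r+1}/q_{r+1}\in\mathfrak{SF}_Q$ and $a_2/q_2,\ldots,a_r/q_r\notin\mathfrak{SF}_Q$. Then $q_1+q_{r+1}\le Q$.
   Context: $\mathcal F_Q:=\{d/b: 1\le d\le b\le Q,\ \gcd(d,b)=1\}$. For a reduced fraction $a/q\in(0,1]$ with $q\ge2$, $\bar a$ is the inverse of $a$ modulo $q$ in $[1,q)$ and $h(a/q):=q+a+\bar a$; $h(1/1):=3$; $\mathfrak{SF}_Q:=\{a/q\in\mathbb Q\cap(0,1]:h(a/q)\le Q\}$. Consecutive means adjacent in increasing order. -}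

module Defs where

open import Data.Nat using (ℕ; _+_; _*_; _≤_; _<_; _≡ᵇ_)
open import Data.Nat.Coprimality using (Coprime)
open import Data.Product using (_×_; Σ)
open import Data.Sum using (_⊎_)
open import Relation.Binary.PropositionalEquality using (_≡_)
open import Relation.Nullary using (¬_)

InFarey : ℕ → ℕ → ℕ → Set
InFarey Q a q = 1 ≤ a × a ≤ q × q ≤ Q × Coprime a q

FracLt : ℕ → ℕ → ℕ → ℕ → Set
FracLt a q b s = a * s < b * q

Consecutive : ℕ → ℕ → ℕ → ℕ → ℕ → Set
Consecutive Q a q b s =
  FracLt a q b s ×
  ((c t : ℕ) → InFarey Q c t → ¬ (FracLt a q c t × FracLt c t b s))

IsInvMod : ℕ → ℕ → ℕ → Set
IsInvMod q a abar = 1 ≤ abar × abar < q × Σ ℕ (λ k → a * abar ≡ 1 + k * q)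

-- Membership of the reduced fraction a/q ∈ (0,1] in SF_Q, i.e. h(a/q) ≤ Q,
-- where h(1/1) = 3 and for q ≥ 2, h(a/q) = q + a + abar.
InSF : ℕ → ℕ → ℕ → Set
InSF Q a q =
  (a ≡ 1 × q ≡ 1 × 3 ≤ Q) ⊎
  (2 ≤ q × Σ ℕ (λ abar → IsInvMod q a abar × q + a + abar ≤ Q))

{-# OPTIONS --safe #-}
-- If a ā = 1 + k q with ā the inverse of a modulo q, then k/ā and (a − k)/(q − ā) are the
-- left and right Farey neighbours of a/q, and both have height at most h(a/q).  So the right
-- neighbour R of x = a₀/q₀ and the left neighbour L of y = a_r/q_r (0/1 when y = 1/1) lie in
-- SF_Q (L when positive).  The only elements of F_Q strictly between x and y are the interior
-- a_i/q_i, which are not in SF_Q; hence R ≥ y and L ≤ x.  If R = y or L = x, then x and y are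
-- neighbours and a₁/q₁, strictly between them, has denominator q₀ + q_r ≤ q₁ ≤ Q.  Otherwise
-- y lies strictly between the neighbours x and R, forcing q₀ < q_r, and symmetrically x lies
-- strictly between L and y, forcing q_r < q₀.
module Submission where

open import Defs
open import Data.Nat using (ℕ; suc; _+_; _≤_; _<_)
open import Relation.Nullary using (¬_)

open import Data.Nat using (zero; _*_; _∸_; _%_; _/_; z≤n; s≤s; NonZero; >-nonZero)
open import Data.Nat.Properties
open import Data.Nat.DivMod using (m≡m%n+[m/n]*n; %-distribˡ-*; m%n%n≡m%n; [m+kn]%n≡m%n; m%n<n; m%n≤m)
open import Data.Nat.Divisibility using (_∣_; divides; ∣-antisym; ∣-trans; ∣m+n∣m⇒∣n; ∣1⇒≡1; m∣m*n; n∣m*n)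
open import Data.Nat.Coprimality using (Coprime; coprime-divisor) renaming (sym to coprime-sym)
open import Data.Nat.Tactic.RingSolver using (solve)
open import Data.List using ([]; _∷_)
open import Data.Product using (Σ; _×_; _,_; proj₁; proj₂)
open import Data.Sum using (_⊎_; inj₁; inj₂)
open import Data.Empty using (⊥-elim)
open import Relation.Binary using (tri<; tri≈; tri>)
open import Relation.Binary.PropositionalEquality

record Neighbours (c t d v : ℕ) : Set where
  constructor neighbours
  field determinant : d * t ≡ 1 + c * v

m*n≡1+o⇒1≤m : ∀ m {n o} → m * n ≡ 1 + o → 1 ≤ m
m*n≡1+o⇒1≤m (suc _) _ = s≤s z≤n

m*n≡1+o⇒1≤n : ∀ m {n o} → m * n ≡ 1 + o → 1 ≤ n
m*n≡1+o⇒1≤n m {zero} eq with () ← trans (sym (*-zeroʳ m)) eq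
m*n≡1+o⇒1≤n m {suc _} _ = s≤s z≤n

denominator-pos : ∀ {Q a q} → InFarey Q a q → 1 ≤ q
denominator-pos (1≤a , a≤q , _) = ≤-trans 1≤a a≤q

denominator≤bound : ∀ {Q a q} → InFarey Q a q → q ≤ Q
denominator≤bound (_ , _ , q≤Q , _) = q≤Q

numerator≤denominator : ∀ {Q a q} → InFarey Q a q → a ≤ q
numerator≤denominator (_ , a≤q , _) = a≤q

coprime : ∀ {Q a q} → InFarey Q a q → Coprime a q
coprime (_ , _ , _ , a⊥q) = a⊥q

FracLt-trans : ∀ a q c t b s → 1 ≤ s → FracLt a q c t → FracLt c t b s → FracLt a q b s
FracLt-trans a q c t b s 1≤s at<cq cs<bt = *-cancelʳ-< t (a * s) (b * q) (begin-strict
  a * s * t  ≡⟨ solve (a ∷ s ∷ t ∷ []) ⟩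
  a * t * s  <⟨ *-monoˡ-< s at<cq ⟩
  c * q * s  ≡⟨ solve (c ∷ q ∷ s ∷ []) ⟩
  c * s * q  ≤⟨ *-monoˡ-≤ q (<⇒≤ cs<bt) ⟩
  b * t * q  ≡⟨ solve (b ∷ t ∷ q ∷ []) ⟩
  b * q * t  ∎)
  where
  open ≤-Reasoning
  instance
    s≢0 : NonZero s
    s≢0 = >-nonZero 1≤s

FracLt⇒1≤numerator : ∀ {a q c t} → FracLt a q c t → 1 ≤ c
FracLt⇒1≤numerator {c = suc _} _ = s≤s z≤n

FracLt⇒numerator<denominator : ∀ {a q b s} → b ≤ s → FracLt a q b s → a < q
FracLt⇒numerator<denominator {a} {q} {b} {s} b≤s as<bq = *-cancelʳ-< s a q (begin-strict
  a * s  <⟨ as<bq ⟩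
  b * q  ≤⟨ *-monoˡ-≤ q b≤s ⟩
  s * q  ≡⟨ *-comm s q ⟩
  q * s  ∎)
  where open ≤-Reasoning

neighbours⇒FracLt : ∀ {c t d v} → Neighbours c t d v → FracLt c t d v
neighbours⇒FracLt (neighbours dt≡) = ≤-reflexive (sym dt≡)

-- u = t (d u − e v) + v (e t − c u), because d t − c v = 1.
between-neighbours⇒≤ : ∀ {c t d v} e u → Neighbours c t d v →
  FracLt c t e u → FracLt e u d v → t + v ≤ u
between-neighbours⇒≤ {c} {t} {d} {v} e u (neighbours dt≡) cu<et ev<du =
  +-cancelʳ-≤ (c * u * v) (t + v) u (begin
    t + v + c * u * v      ≡⟨ +-assoc t v _ ⟩
    t + (v + c * u * v)    ≤⟨ +-monoʳ-≤ t (*-monoˡ-≤ v cu<et) ⟩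
    t + e * t * v          ≡⟨ cong (t +_) (solve (e ∷ t ∷ v ∷ [])) ⟩
    t + e * v * t          ≤⟨ *-monoˡ-≤ t ev<du ⟩
    d * u * t              ≡⟨ solve (d ∷ u ∷ t ∷ []) ⟩
    u * (d * t)            ≡⟨ cong (u *_) dt≡ ⟩
    u * (1 + c * v)        ≡⟨ solve (u ∷ c ∷ v ∷ []) ⟩
    u + c * u * v          ∎)
  where open ≤-Reasoning

lowest-terms-unique : ∀ {c t a q} → Coprime c t → Coprime a q → 1 ≤ q →
  c * q ≡ a * t → c ≡ a × t ≡ q
lowest-terms-unique {c} {t} {a} {q@(suc _)} c⊥t a⊥q _ cq≡at = c≡a , t≡q
  where
  t≡q : t ≡ q
  t≡q = ∣-antisym (coprime-divisor (coprime-sym c⊥t) (divides a cq≡at))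
                  (coprime-divisor (coprime-sym a⊥q) (divides c (sym cq≡at)))
  c≡a : c ≡ a
  c≡a = *-cancelʳ-≡ c a q (trans cq≡at (cong (a *_) t≡q))

neighbours-common-divisor : ∀ {c t d v k} → Neighbours c t d v → k ∣ d * t → k ∣ c * v → k ≡ 1
neighbours-common-divisor {c} {t} {d} {v} {k} (neighbours dt≡) k∣dt k∣cv =
  ∣1⇒≡1 (∣m+n∣m⇒∣n (subst (k ∣_) (trans dt≡ (+-comm 1 (c * v))) k∣dt) k∣cv)

neighbours-coprimeˡ : ∀ {c t d v} → Neighbours c t d v → Coprime c t
neighbours-coprimeˡ {d = d} {v} c/t~d/v (k∣c , k∣t) =
  neighbours-common-divisor c/t~d/v (∣-trans k∣t (n∣m*n d)) (∣-trans k∣c (m∣m*n v))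

neighbours-coprimeʳ : ∀ {c t d v} → Neighbours c t d v → Coprime d v
neighbours-coprimeʳ {c} {t} c/t~d/v (k∣d , k∣v) =
  neighbours-common-divisor c/t~d/v (∣-trans k∣d (m∣m*n t)) (∣-trans k∣v (n∣m*n c))

reduce-inverse : ∀ {n x e k} → 2 ≤ n → x * e ≡ 1 + k * n →
  Σ ℕ λ e′ → e′ ≤ e × IsInvMod n x e′
reduce-inverse {suc zero} (s≤s ())
reduce-inverse {n@(suc (suc _))} {x} {e} {k} _ xe≡ =
  e % n , m%n≤m e n , m*n≡1+o⇒1≤n x xe′≡ , m%n<n e n , x * (e % n) / n , xe′≡
  where
  xe′%n≡1 : x * (e % n) % n ≡ 1
  xe′%n≡1 = begin
    x * (e % n) % n          ≡⟨ %-distribˡ-* x (e % n) n ⟩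
    x % n * (e % n % n) % n  ≡⟨ cong (λ m → x % n * m % n) (m%n%n≡m%n e n) ⟩
    x % n * (e % n) % n      ≡⟨ %-distribˡ-* x e n ⟨
    x * e % n                ≡⟨ cong (_% n) xe≡ ⟩
    (1 + k * n) % n          ≡⟨ [m+kn]%n≡m%n 1 k n ⟩
    1                        ∎
    where open ≡-Reasoning
  xe′≡ : x * (e % n) ≡ 1 + x * (e % n) / n * n
  xe′≡ = trans (m≡m%n+[m/n]*n (x * (e % n)) n) (cong (_+ x * (e % n) / n * n) xe′%n≡1)

-- h(c/t) is computed from the inverse reduced modulo t, which is at most e and below t.
InSF-intro : ∀ {Q c t e k} → 3 ≤ Q → 1 ≤ c → c ≤ t → c * e ≡ 1 + k * t →
  (∀ {e′} → e′ ≤ e → e′ < t → t + c + e′ ≤ Q) → InSF Q c t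
InSF-intro {t = zero} _ (s≤s _) ()
InSF-intro {t = 1} Q≥3 (s≤s z≤n) (s≤s z≤n) _ _ = inj₁ (refl , refl , Q≥3)
InSF-intro {c = c} {t = suc (suc _)} {k = k} _ _ _ ce≡ bound
  with reduce-inverse {x = c} {k = k} (s≤s (s≤s z≤n)) ce≡
... | e′ , e′≤e , inv@(_ , e′<t , _) = inj₂ (s≤s (s≤s z≤n) , e′ , inv , bound e′≤e e′<t)

-- a/q is the mediant of its two neighbours k/ā and c/t.
opposite-neighbour : ∀ {k ā a q c t} → c + k ≡ a → t + ā ≡ q → a * ā ≡ 1 + k * q →
  c * ā ≡ 1 + k * t × Neighbours a q c t
opposite-neighbour {k} {ā} {c = c} {t} refl refl aā≡ = cā≡ , neighbours cq≡
  where
  open ≡-Reasoning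
  cā≡ : c * ā ≡ 1 + k * t
  cā≡ = +-cancelʳ-≡ (k * ā) (c * ā) (1 + k * t) (begin
    c * ā + k * ā      ≡⟨ *-distribʳ-+ ā c k ⟨
    (c + k) * ā        ≡⟨ aā≡ ⟩
    1 + k * (t + ā)    ≡⟨ solve (k ∷ t ∷ ā ∷ []) ⟩
    1 + k * t + k * ā  ∎)
  cq≡ : c * (t + ā) ≡ 1 + (c + k) * t
  cq≡ = begin
    c * (t + ā)        ≡⟨ *-distribˡ-+ c t ā ⟩
    c * t + c * ā      ≡⟨ cong (c * t +_) cā≡ ⟩
    c * t + (1 + k * t) ≡⟨ solve (c ∷ t ∷ k ∷ []) ⟩
    1 + (c + k) * t    ∎

rightNeighbour : ∀ {Q a q} → 3 ≤ Q → InFarey Q a q → InSF Q a q → a < q →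
  Σ ℕ λ c → Σ ℕ λ t → Neighbours a q c t × InFarey Q c t × InSF Q c t
rightNeighbour _ _ (inj₁ (refl , refl , _)) (s≤s ())
rightNeighbour {Q} {a} {q} Q≥3 (_ , a≤q , q≤Q , _)
               (inj₂ (q≥2 , ā , (_ , ā<q , k , aā≡) , h≤Q)) _ =
  c , t , a/q~c/t , (1≤c , c≤t , ≤-trans (m∸n≤m q ā) q≤Q , neighbours-coprimeʳ a/q~c/t) ,
  InSF-intro {k = k} Q≥3 1≤c c≤t cā≡ bound
  where
  open ≤-Reasoning
  k<a : k < a
  k<a = *-cancelʳ-< q k a (begin-strict
    k * q      <⟨ n<1+n (k * q) ⟩
    1 + k * q  ≡⟨ aā≡ ⟨
    a * ā      ≤⟨ *-monoʳ-≤ a (<⇒≤ ā<q) ⟩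
    a * q      ∎)
  c t : ℕ
  c = a ∸ k
  t = q ∸ ā
  split : c * ā ≡ 1 + k * t × Neighbours a q c t
  split = opposite-neighbour {k} {ā} {c = c} (m∸n+n≡m (<⇒≤ k<a)) (m∸n+n≡m (<⇒≤ ā<q)) aā≡
  cā≡ : c * ā ≡ 1 + k * t
  cā≡ = proj₁ split
  a/q~c/t : Neighbours a q c t
  a/q~c/t = proj₂ split
  1≤c : 1 ≤ c
  1≤c = m*n≡1+o⇒1≤m c (Neighbours.determinant a/q~c/t)
  c≤t : c ≤ t
  c≤t = ≤-pred (*-cancelʳ-< q c (suc t) (begin-strict
    c * q      ≡⟨ Neighbours.determinant a/q~c/t ⟩
    1 + a * t  ≤⟨ +-monoʳ-≤ 1 (*-monoˡ-≤ t a≤q) ⟩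
    1 + q * t  <⟨ +-monoˡ-< (q * t) q≥2 ⟩
    q + q * t  ≡⟨ cong (q +_) (*-comm q t) ⟩
    suc t * q  ∎))
  bound : ∀ {e′} → e′ ≤ ā → e′ < t → t + c + e′ ≤ Q
  bound e′≤ā _ = ≤-trans (+-mono-≤ (+-mono-≤ (m∸n≤m q ā) (m∸n≤m a k)) e′≤ā) h≤Q

-- k s ≡ −1 (mod t), so (t − 1) s inverts k modulo t.
negated-inverse : ∀ {k t b s j} → 1 ≤ t → b + j ≡ k * s → b * t ≡ 1 + k * s →
  k * ((t ∸ 1) * s) ≡ 1 + j * t
negated-inverse {k} {suc β} {b} {s} {j} _ b+j≡ks bt≡ = begin
  k * (β * s)    ≡⟨ solve (k ∷ β ∷ s ∷ []) ⟩
  k * s * β      ≡⟨ cong (_* β) b+j≡ks ⟨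
  (b + j) * β    ≡⟨ *-distribʳ-+ β b j ⟩
  b * β + j * β  ≡⟨ cong (_+ j * β) bβ≡ ⟩
  1 + j + j * β  ≡⟨ solve (j ∷ β ∷ []) ⟩
  1 + j * suc β  ∎
  where
  open ≡-Reasoning
  bβ≡ : b * β ≡ 1 + j
  bβ≡ = +-cancelˡ-≡ b (b * β) (1 + j) (begin
    b + b * β      ≡⟨ *-suc b β ⟨
    b * suc β      ≡⟨ bt≡ ⟩
    1 + k * s      ≡⟨ cong (1 +_) b+j≡ks ⟨
    1 + (b + j)    ≡⟨ solve (b ∷ j ∷ []) ⟩
    b + (1 + j)    ∎)

leftNeighbour : ∀ {Q b s} → 3 ≤ Q → InFarey Q b s → InSF Q b s →
  Σ ℕ λ c → Σ ℕ λ t → Neighbours c t b s × (1 ≤ c → InFarey Q c t × InSF Q c t)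
leftNeighbour _ _ (inj₁ (refl , refl , _)) = 0 , 1 , neighbours refl , λ ()
leftNeighbour {Q} {b} {s} Q≥3 (_ , b≤s , s≤Q , _)
              (inj₂ (_ , b̄ , (1≤b̄ , b̄<s , k , bb̄≡) , h≤Q)) =
  k , b̄ , neighbours bb̄≡ , member
  where
  open ≤-Reasoning
  k<b̄ : k < b̄
  k<b̄ = *-cancelʳ-< s k b̄ (begin-strict
    k * s      <⟨ n<1+n (k * s) ⟩
    1 + k * s  ≡⟨ bb̄≡ ⟨
    b * b̄      ≤⟨ *-monoˡ-≤ b̄ b≤s ⟩
    s * b̄      ≡⟨ *-comm s b̄ ⟩
    b̄ * s      ∎)
  k<b : k < b
  k<b = *-cancelʳ-< s k b (begin-strict
    k * s      <⟨ n<1+n (k * s) ⟩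
    1 + k * s  ≡⟨ bb̄≡ ⟨
    b * b̄      ≤⟨ *-monoʳ-≤ b (<⇒≤ b̄<s) ⟩
    b * s      ∎)
  bound : ∀ {e′} → e′ ≤ (b̄ ∸ 1) * s → e′ < b̄ → b̄ + k + e′ ≤ Q
  bound {e′} _ e′<b̄ = ≤-trans (begin
    b̄ + k + e′  ≤⟨ +-mono-≤ (+-monoʳ-≤ b̄ (<⇒≤ k<b)) (<⇒≤ (<-trans e′<b̄ b̄<s)) ⟩
    b̄ + b + s   ≡⟨ solve (b̄ ∷ b ∷ s ∷ []) ⟩
    s + b + b̄   ∎) h≤Q
  member : 1 ≤ k → InFarey Q k b̄ × InSF Q k b̄
  member 1≤k =
    (1≤k , <⇒≤ k<b̄ , ≤-trans (<⇒≤ b̄<s) s≤Q , neighbours-coprimeˡ {d = b} (neighbours bb̄≡)) ,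
    InSF-intro {k = k * s ∸ b} Q≥3 1≤k (<⇒≤ k<b̄) inverse bound
    where
    b≤ks : b ≤ k * s
    b≤ks = ≤-trans b≤s (m≤n*m s k {{>-nonZero 1≤k}})
    inverse : k * ((b̄ ∸ 1) * s) ≡ 1 + (k * s ∸ b) * b̄
    inverse = negated-inverse {k} {b̄} {b} {s} 1≤b̄ (m+[n∸m]≡n b≤ks) bb̄≡

module Chain {Q r : ℕ} {a q : ℕ → ℕ}
  (F : (i : ℕ) → i ≤ r → InFarey Q (a i) (q i))
  (C : (i : ℕ) → i < r → Consecutive Q (a i) (q i) (a (suc i)) (q (suc i))) where

  increasing : ∀ {i j} → i < j → j ≤ r → FracLt (a i) (q i) (a j) (q j)
  increasing {i} {suc j} i<1+j j<r with m≤n⇒m<n∨m≡n (≤-pred i<1+j)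
  ... | inj₂ refl = proj₁ (C j j<r)
  ... | inj₁ i<j  =
    FracLt-trans (a i) (q i) (a j) (q j) (a (suc j)) (q (suc j)) (denominator-pos (F (suc j) j<r))
                 (increasing i<j (<⇒≤ j<r)) (proj₁ (C j j<r))

  equals-chain-element : ∀ {i c t} → i ≤ r → Coprime c t → c * q i ≡ a i * t → c ≡ a i × t ≡ q i
  equals-chain-element i≤r c⊥t =
    lowest-terms-unique c⊥t (coprime (F _ i≤r)) (denominator-pos (F _ i≤r))

  between⇒interior : ∀ {j c t} → j ≤ r → InFarey Q c t →
    FracLt (a 0) (q 0) c t → FracLt c t (a j) (q j) →
    Σ ℕ λ i → 1 ≤ i × i < j × c ≡ a i × t ≡ q i
  between⇒interior {zero} _ _ x₀<c/t c/t<x₀ = ⊥-elim (<-asym x₀<c/t c/t<x₀)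
  between⇒interior {suc j} {c} {t} j<r c/t∈F x₀<c/t c/t<xⱼ₊₁ with <-cmp (c * q j) (a j * t)
  ... | tri< c/t<xⱼ _ _ =
    let i , 1≤i , i<j , c/t≡xᵢ = between⇒interior (<⇒≤ j<r) c/t∈F x₀<c/t c/t<xⱼ
    in  i , 1≤i , m<n⇒m<1+n i<j , c/t≡xᵢ
  ... | tri> _ _ xⱼ<c/t = ⊥-elim (proj₂ (C j j<r) c t c/t∈F (xⱼ<c/t , c/t<xⱼ₊₁))
  ... | tri≈ _ c/t=xⱼ _ = j , 1≤j , ≤-refl , equals-chain-element (<⇒≤ j<r) (coprime c/t∈F) c/t=xⱼ
    where
    1≤j : 1 ≤ j
    1≤j = n≢0⇒n>0 λ { refl → <-irrefl (sym c/t=xⱼ) x₀<c/t }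

  InteriorOutsideSF : Set
  InteriorOutsideSF = (i : ℕ) → 1 ≤ i → i < r → ¬ InSF Q (a i) (q i)

  no-SF-between-ends : InteriorOutsideSF → ∀ {c t} → InFarey Q c t → InSF Q c t →
    ¬ (FracLt (a 0) (q 0) c t × FracLt c t (a r) (q r))
  no-SF-between-ends outside c/t∈F c/t∈SF (x₀<c/t , c/t<xᵣ)
    with between⇒interior ≤-refl c/t∈F x₀<c/t c/t<xᵣ
  ... | i , 1≤i , i<r , refl , refl = outside i 1≤i i<r c/t∈SF

  ends-neighbours⇒q₀+qᵣ≤Q : 2 ≤ r → Neighbours (a 0) (q 0) (a r) (q r) → q 0 + q r ≤ Q
  ends-neighbours⇒q₀+qᵣ≤Q r≥2 x₀~xᵣ = ≤-trans
    (between-neighbours⇒≤ (a 1) (q 1) x₀~xᵣ (proj₁ (C 0 (<⇒≤ r≥2))) (increasing r≥2 ≤-refl))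
    (denominator≤bound (F 1 (<⇒≤ r≥2)))

  ends-neighbours⊎q₀<qᵣ : 3 ≤ Q → 1 ≤ r → InteriorOutsideSF → InSF Q (a 0) (q 0) →
    Neighbours (a 0) (q 0) (a r) (q r) ⊎ q 0 < q r
  ends-neighbours⊎q₀<qᵣ Q≥3 r≥1 outside x₀∈SF with rightNeighbour Q≥3 (F 0 z≤n) x₀∈SF a₀<q₀
    where
    a₀<q₀ : a 0 < q 0
    a₀<q₀ = FracLt⇒numerator<denominator (numerator≤denominator (F r ≤-refl))
                                          (increasing r≥1 ≤-refl)
  ... | c , t , x₀~c/t , c/t∈F , c/t∈SF with <-cmp (c * q r) (a r * t)
  ...   | tri< c/t<xᵣ _ _ =
    ⊥-elim (no-SF-between-ends outside c/t∈F c/t∈SF (neighbours⇒FracLt x₀~c/t , c/t<xᵣ))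
  ...   | tri> _ _ xᵣ<c/t = inj₂ (begin-strict
      q 0      <⟨ m<m+n (q 0) (denominator-pos c/t∈F) ⟩
      q 0 + t  ≤⟨ between-neighbours⇒≤ (a r) (q r) x₀~c/t (increasing r≥1 ≤-refl) xᵣ<c/t ⟩
      q r      ∎)
    where open ≤-Reasoning
  ...   | tri≈ _ c/t=xᵣ _ with equals-chain-element ≤-refl (neighbours-coprimeʳ x₀~c/t) c/t=xᵣ
  ...     | refl , refl = inj₁ x₀~c/t

  ends-neighbours⊎qᵣ<q₀ : 3 ≤ Q → 1 ≤ r → InteriorOutsideSF → InSF Q (a r) (q r) →
    Neighbours (a 0) (q 0) (a r) (q r) ⊎ q r < q 0
  ends-neighbours⊎qᵣ<q₀ Q≥3 r≥1 outside xᵣ∈SF with leftNeighbour Q≥3 (F r ≤-refl) xᵣ∈SF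
  ... | c , t , c/t~xᵣ , member with <-cmp (c * q 0) (a 0 * t)
  ...   | tri< c/t<x₀ _ _ = inj₂ (begin-strict
      q r      <⟨ m<n+m (q r) (m*n≡1+o⇒1≤n (a r) (Neighbours.determinant c/t~xᵣ)) ⟩
      t + q r  ≤⟨ between-neighbours⇒≤ (a 0) (q 0) c/t~xᵣ c/t<x₀ (increasing r≥1 ≤-refl) ⟩
      q 0      ∎)
    where open ≤-Reasoning
  ...   | tri> _ _ x₀<c/t =
    let c/t∈F , c/t∈SF = member (FracLt⇒1≤numerator {a 0} {q 0} x₀<c/t)
    in  ⊥-elim (no-SF-between-ends outside c/t∈F c/t∈SF (x₀<c/t , neighbours⇒FracLt c/t~xᵣ))
  ...   | tri≈ _ c/t=x₀ _ with equals-chain-element z≤n (neighbours-coprimeˡ c/t~xᵣ) c/t=x₀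
  ...     | refl , refl = inj₁ c/t~xᵣ

lemma6 : (Q r : ℕ) → 3 ≤ Q → 2 ≤ r →
    (a q : ℕ → ℕ) →
    ((i : ℕ) → i ≤ r → InFarey Q (a i) (q i)) →
    ((i : ℕ) → i < r → Consecutive Q (a i) (q i) (a (suc i)) (q (suc i))) →
    InSF Q (a 0) (q 0) →
    InSF Q (a r) (q r) →
    ((i : ℕ) → 1 ≤ i → i < r → ¬ InSF Q (a i) (q i)) →
    q 0 + q r ≤ Q
lemma6 Q r Q≥3 r≥2 a q F C x₀∈SF xᵣ∈SF outside =
  conclude (ends-neighbours⊎q₀<qᵣ Q≥3 (<⇒≤ r≥2) outside x₀∈SF)
           (ends-neighbours⊎qᵣ<q₀ Q≥3 (<⇒≤ r≥2) outside xᵣ∈SF)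
  where
  open Chain F C
  conclude : Neighbours (a 0) (q 0) (a r) (q r) ⊎ q 0 < q r →
             Neighbours (a 0) (q 0) (a r) (q r) ⊎ q r < q 0 → q 0 + q r ≤ Q
  conclude (inj₁ x₀~xᵣ) _          = ends-neighbours⇒q₀+qᵣ≤Q r≥2 x₀~xᵣ
  conclude (inj₂ _)     (inj₁ x₀~xᵣ) = ends-neighbours⇒q₀+qᵣ≤Q r≥2 x₀~xᵣ
  conclude (inj₂ q₀<qᵣ) (inj₂ qᵣ<q₀) = ⊥-elim (<-asym q₀<qᵣ qᵣ<q₀)
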